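{- Let $r\geq 1$, let $\mathbf a=(a_1,\ldots,a_r)$ be positive integers and let $D$ be a common multiple of $a_1,\ldots,a_r$. For every integer $n\geq 0$, $$ p_{\mathbf a}(n) = \sum_{j=0}^{\lfloor n/D\rfloor} \binom{r+j-1}{j} f_{\mathbf a}(n-jD). $$
   Context: $p_{\mathbf a}(n)$ is the restricted partition function: the number of integer solutions $(x_1,\ldots,x_r)$ of $a_1x_1+\cdots+a_rx_r=n$ with all $x_i\geq 0$. For $n\geq 0$, $f_{\mathbf a}(n)$ denotes the number of integer tuples $(j_1,\ldots,j_r)$ with $a_1j_1+\cdots+a_rj_r=n$ and $0\leq j_k\leq \frac{D}{a_k}-1$ for $1\leq k\leq r$. -}

module Defs where

open import Data.Nat using (ℕ; zero; suc; _+_; _*_; _∸_; _<_; _≟_; NonZero; >-nonZero)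
open import Data.Nat.DivMod using (_/_)
open import Data.Fin using (Fin; zero; suc)
open import Data.List using (List; []; _∷_; map; concatMap; upTo; filter; length)

wsum : (r : ℕ) → (Fin r → ℕ) → (Fin r → ℕ) → ℕ
wsum zero    a x = 0
wsum (suc r) a x = a zero * x zero + wsum r (λ k → a (suc k)) (λ k → x (suc k))

cons : {r : ℕ} → ℕ → (Fin r → ℕ) → (Fin (suc r) → ℕ)
cons v x zero    = v
cons v x (suc k) = x k

boxTuples : (r : ℕ) → (Fin r → ℕ) → List (Fin r → ℕ)
boxTuples zero    b = (λ ()) ∷ []
boxTuples (suc r) b =
  concatMap (λ v → map (cons v) (boxTuples r (λ k → b (suc k)))) (upTo (b zero))

countBox : (r : ℕ) → (a b : Fin r → ℕ) → ℕ → ℕ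
countBox r a b n = length (filter (λ x → wsum r a x ≟ n) (boxTuples r b))

-- restricted partition function p_a(n) (for positive a_k).
-- Any solution has x_k ≤ a_k x_k ≤ n, so the box 0 ≤ x_k ≤ n contains all solutions.
pa : (r : ℕ) → (Fin r → ℕ) → ℕ → ℕ
pa r a n = countBox r a (λ _ → suc n) n

-- f_a(n): tuples with 0 ≤ j_k ≤ D/a_k - 1, i.e. 0 ≤ j_k < D/a_k
fa : (r : ℕ) → (a : Fin r → ℕ) → (∀ k → 0 < a k) → (D : ℕ) → ℕ → ℕ
fa r a pos D n = countBox r a (λ k → _/_ D (a k) {{>-nonZero (pos k)}}) n

-- Read f : ℕ → ℕ as the power series Σ f(m) tᵐ. Counting solutions of a₁x₁ + ⋯ + a_r x_r = m
-- gives ∏ₖ 1/(1 - t^{aₖ}), and since aₖ dₖ = D with dₖ = D/aₖ every factor splits as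
-- 1/(1 - t^D) · (1 + t^{aₖ} + ⋯ + t^{aₖ(dₖ - 1)}); the second factors multiply to the generating
-- polynomial of f_a. Hence p_a has generating function (1 - t^D)^{-r} times that of f_a, and
-- (1 - t^D)^{-r} = Σⱼ C(r + j - 1, j) t^{jD} by the hockey-stick identity. All of this is done
-- modulo t^N, with N = n + 1 large enough that the box 0 ≤ xₖ ≤ n already sees every solution;
-- product coefficients are written with Kronecker deltas δ (i + j) m, so no truncated
-- subtraction ever appears.

module Submission where

open import Defs
open import Data.Nat using (ℕ; zero; suc; _+_; _*_; _∸_; _<_; _≤_; _≟_; z≤n; s≤s; z<s; s<s; NonZero; >-nonZero; ≢-nonZero⁻¹)
open import Data.Nat.Properties
open import Data.Nat.DivMod using (_/_; m*[n/m]≡n; m/n≤m; m/n*n≤m; m*n/n≡m; /-monoˡ-≤)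
open import Data.Nat.Divisibility using (_∣_)
open import Data.Nat.Combinatorics using (_C_; k>n⇒nCk≡0; nCk+nC[k+1]≡[n+1]C[k+1])
open import Data.Nat.ListAction using (sum)
open import Data.Nat.Tactic.RingSolver using (solve-∀)
open import Data.Fin using (Fin; zero; suc)
open import Data.List using (List; []; _∷_; map; concatMap; upTo; applyUpTo; filter; length; _++_; cartesianProduct)
open import Data.List.Properties using (filter-accept; filter-reject)
open import Data.Product using (_×_; _,_)
open import Data.Empty using (⊥-elim)
open import Function using (_∘_; id)
open import Relation.Nullary using (yes; no)
open import Relation.Binary.PropositionalEquality using (_≡_; _≢_; refl; sym; trans; cong; cong₂; subst; module ≡-Reasoning)
open import Level using (0ℓ)
import Relation.Binary.Reasoning.Setoid as SetoidReasoning
open import Algebra.Bundles using (CommutativeSemigroup)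
open import Algebra.Properties.CommutativeSemigroup +-commutativeSemigroup using ()
  renaming (interchange to +-interchange)
open import Algebra.Properties.CommutativeSemigroup *-commutativeSemigroup using ()
  renaming (x∙yz≈y∙xz to m*[n*o]≡n*[m*o])

δ : ℕ → ℕ → ℕ
δ zero    zero    = 1
δ zero    (suc _) = 0
δ (suc _) zero    = 0
δ (suc m) (suc n) = δ m n

δ-refl : ∀ n → δ n n ≡ 1
δ-refl zero    = refl
δ-refl (suc n) = δ-refl n

δ-≢ : ∀ m n → m ≢ n → δ m n ≡ 0
δ-≢ zero    zero    m≢n = ⊥-elim (m≢n refl)
δ-≢ zero    (suc n) m≢n = refl
δ-≢ (suc m) zero    m≢n = refl
δ-≢ (suc m) (suc n) m≢n = δ-≢ m n (m≢n ∘ cong suc)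

δ-> : ∀ {m n} → n < m → δ m n ≡ 0
δ-> {m} {n} n<m = δ-≢ m n (λ m≡n → <-irrefl (sym m≡n) n<m)

δ-sym : ∀ m n → δ m n ≡ δ n m
δ-sym zero    zero    = refl
δ-sym zero    (suc n) = refl
δ-sym (suc m) zero    = refl
δ-sym (suc m) (suc n) = δ-sym m n

δ-cancelˡ-+ : ∀ k m n → δ (k + m) (k + n) ≡ δ m n
δ-cancelˡ-+ zero    m n = refl
δ-cancelˡ-+ (suc k) m n = δ-cancelˡ-+ k m n

δ-+-∸ : ∀ k m n → k ≤ n → δ (k + m) n ≡ δ m (n ∸ k)
δ-+-∸ k m n k≤n = trans (cong (δ (k + m)) (sym (m+[n∸m]≡n k≤n))) (δ-cancelˡ-+ k m (n ∸ k))

Σ< : ℕ → (ℕ → ℕ) → ℕ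
Σ< zero    f = 0
Σ< (suc N) f = f 0 + Σ< N (f ∘ suc)

Σ<-cong : ∀ N {f g : ℕ → ℕ} → (∀ i → i < N → f i ≡ g i) → Σ< N f ≡ Σ< N g
Σ<-cong zero    f≡g = refl
Σ<-cong (suc N) f≡g = cong₂ _+_ (f≡g 0 z<s) (Σ<-cong N (λ i i<N → f≡g (suc i) (s<s i<N)))

Σ<-zeros : ∀ N {f : ℕ → ℕ} → (∀ i → i < N → f i ≡ 0) → Σ< N f ≡ 0
Σ<-zeros zero    f≡0 = refl
Σ<-zeros (suc N) f≡0 = cong₂ _+_ (f≡0 0 z<s) (Σ<-zeros N (λ i i<N → f≡0 (suc i) (s<s i<N)))

Σ<-distrib-+ : ∀ N (f g : ℕ → ℕ) → Σ< N (λ i → f i + g i) ≡ Σ< N f + Σ< N g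
Σ<-distrib-+ zero    f g = refl
Σ<-distrib-+ (suc N) f g =
  trans (cong (f 0 + g 0 +_) (Σ<-distrib-+ N _ _)) (+-interchange (f 0) (g 0) _ _)

*-distribˡ-Σ< : ∀ N c (f : ℕ → ℕ) → c * Σ< N f ≡ Σ< N (λ i → c * f i)
*-distribˡ-Σ< zero    c f = *-zeroʳ c
*-distribˡ-Σ< (suc N) c f =
  trans (*-distribˡ-+ c (f 0) _) (cong (c * f 0 +_) (*-distribˡ-Σ< N c _))

Σ<-+ : ∀ M K (f : ℕ → ℕ) → Σ< (M + K) f ≡ Σ< M f + Σ< K (λ i → f (M + i))
Σ<-+ zero    K f = refl
Σ<-+ (suc M) K f = trans (cong (f 0 +_) (Σ<-+ M K _)) (sym (+-assoc (f 0) _ _))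

Σ<-suc : ∀ N (f : ℕ → ℕ) → Σ< (suc N) f ≡ Σ< N f + f N
Σ<-suc N f = begin
  Σ< (suc N) f                ≡⟨ cong (λ t → Σ< t f) (+-comm 1 N) ⟩
  Σ< (N + 1) f                ≡⟨ Σ<-+ N 1 f ⟩
  Σ< N f + (f (N + 0) + 0)    ≡⟨ cong (Σ< N f +_) (trans (+-identityʳ _) (cong f (+-identityʳ N))) ⟩
  Σ< N f + f N                ∎
  where open ≡-Reasoning

Σ<-* : ∀ Q d (f : ℕ → ℕ) → Σ< (Q * d) f ≡ Σ< Q (λ q → Σ< d (λ v → f (q * d + v)))
Σ<-* zero    d f = refl
Σ<-* (suc Q) d f = begin
  Σ< (d + Q * d) f                                       ≡⟨ Σ<-+ d (Q * d) f ⟩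
  Σ< d f + Σ< (Q * d) (λ i → f (d + i))                  ≡⟨ cong (Σ< d f +_) (Σ<-* Q d _) ⟩
  Σ< d f + Σ< Q (λ q → Σ< d (λ v → f (d + (q * d + v)))) ≡⟨ cong (Σ< d f +_) (Σ<-cong Q (λ q _ →
                                                              Σ<-cong d (λ v _ → cong f (sym (+-assoc d (q * d) v))))) ⟩
  Σ< d f + Σ< Q (λ q → Σ< d (λ v → f (suc q * d + v)))   ∎
  where open ≡-Reasoning

Σ<-truncate : ∀ K M (f : ℕ → ℕ) → K ≤ M → (∀ i → K ≤ i → f i ≡ 0) → Σ< M f ≡ Σ< K f
Σ<-truncate K M f K≤M f≡0 = begin
  Σ< M f                                  ≡⟨ cong (λ t → Σ< t f) (sym (m+[n∸m]≡n K≤M)) ⟩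
  Σ< (K + (M ∸ K)) f                      ≡⟨ Σ<-+ K (M ∸ K) f ⟩
  Σ< K f + Σ< (M ∸ K) (λ i → f (K + i))   ≡⟨ cong (Σ< K f +_) (Σ<-zeros (M ∸ K) (λ i _ →
                                               f≡0 (K + i) (m≤m+n K i))) ⟩
  Σ< K f + 0                              ≡⟨ +-identityʳ _ ⟩
  Σ< K f                                  ∎
  where open ≡-Reasoning

Σ<-comm : ∀ M N (f : ℕ → ℕ → ℕ) → Σ< M (λ i → Σ< N (f i)) ≡ Σ< N (λ j → Σ< M (λ i → f i j))
Σ<-comm zero    N f = sym (Σ<-zeros N (λ _ _ → refl))
Σ<-comm (suc M) N f = trans (cong (Σ< N (f 0) +_) (Σ<-comm M N _)) (sym (Σ<-distrib-+ N _ _))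

Σ<-δ : ∀ N t (h : ℕ → ℕ) → (N ≤ t → h t ≡ 0) → Σ< N (λ k → δ t k * h k) ≡ h t
Σ<-δ zero    t       h h≡0 = sym (h≡0 z≤n)
Σ<-δ (suc N) zero    h h≡0 = trans (cong₂ _+_ (+-identityʳ (h 0)) (Σ<-zeros N (λ _ _ → refl))) (+-identityʳ (h 0))
Σ<-δ (suc N) (suc t) h h≡0 = Σ<-δ N t (h ∘ suc) (h≡0 ∘ s≤s)

ΣL : {A : Set} → List A → (A → ℕ) → ℕ
ΣL []       f = 0
ΣL (x ∷ xs) f = f x + ΣL xs f

module _ {A : Set} where

  ΣL-cong : ∀ (xs : List A) {f g : A → ℕ} → (∀ x → f x ≡ g x) → ΣL xs f ≡ ΣL xs g
  ΣL-cong []       f≡g = refl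
  ΣL-cong (x ∷ xs) f≡g = cong₂ _+_ (f≡g x) (ΣL-cong xs f≡g)

  ΣL-zeros : ∀ (xs : List A) {f : A → ℕ} → (∀ x → f x ≡ 0) → ΣL xs f ≡ 0
  ΣL-zeros []       f≡0 = refl
  ΣL-zeros (x ∷ xs) f≡0 = cong₂ _+_ (f≡0 x) (ΣL-zeros xs f≡0)

  *-distribˡ-ΣL : ∀ (xs : List A) c (f : A → ℕ) → c * ΣL xs f ≡ ΣL xs (λ x → c * f x)
  *-distribˡ-ΣL []       c f = *-zeroʳ c
  *-distribˡ-ΣL (x ∷ xs) c f = trans (*-distribˡ-+ c (f x) _) (cong (c * f x +_) (*-distribˡ-ΣL xs c f))

  *-distribʳ-ΣL : ∀ (xs : List A) c (f : A → ℕ) → ΣL xs f * c ≡ ΣL xs (λ x → f x * c)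
  *-distribʳ-ΣL xs c f =
    trans (*-comm _ c) (trans (*-distribˡ-ΣL xs c f) (ΣL-cong xs (λ x → *-comm c (f x))))

  ΣL-++ : ∀ (xs ys : List A) (f : A → ℕ) → ΣL (xs ++ ys) f ≡ ΣL xs f + ΣL ys f
  ΣL-++ []       ys f = refl
  ΣL-++ (x ∷ xs) ys f = trans (cong (f x +_) (ΣL-++ xs ys f)) (sym (+-assoc (f x) _ _))

  ΣL-map : ∀ {B : Set} (g : B → A) (xs : List B) (f : A → ℕ) → ΣL (map g xs) f ≡ ΣL xs (f ∘ g)
  ΣL-map g []       f = refl
  ΣL-map g (x ∷ xs) f = cong (f (g x) +_) (ΣL-map g xs f)

  ΣL-concatMap : ∀ {B : Set} (g : B → List A) (xs : List B) (f : A → ℕ) →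
                 ΣL (concatMap g xs) f ≡ ΣL xs (λ x → ΣL (g x) f)
  ΣL-concatMap g []       f = refl
  ΣL-concatMap g (x ∷ xs) f = trans (ΣL-++ (g x) _ f) (cong (ΣL (g x) f +_) (ΣL-concatMap g xs f))

  ΣL-Σ<-comm : ∀ (xs : List A) N (f : A → ℕ → ℕ) →
               ΣL xs (λ x → Σ< N (f x)) ≡ Σ< N (λ i → ΣL xs (λ x → f x i))
  ΣL-Σ<-comm []       N f = sym (Σ<-zeros N (λ _ _ → refl))
  ΣL-Σ<-comm (x ∷ xs) N f = trans (cong (Σ< N (f x) +_) (ΣL-Σ<-comm xs N f)) (sym (Σ<-distrib-+ N _ _))

  sum-map : ∀ (f : A → ℕ) (xs : List A) → sum (map f xs) ≡ ΣL xs f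
  sum-map f []       = refl
  sum-map f (x ∷ xs) = cong (f x +_) (sum-map f xs)

ΣL-*-ΣL : ∀ {A B : Set} (xs : List A) (ys : List B) f g →
          ΣL xs f * ΣL ys g ≡ ΣL xs (λ x → ΣL ys (λ y → f x * g y))
ΣL-*-ΣL xs ys f g = trans (*-distribʳ-ΣL xs _ f) (ΣL-cong xs (λ x → *-distribˡ-ΣL ys (f x) g))

ΣL-cartesianProduct : ∀ {A B : Set} (xs : List A) (ys : List B) f →
                      ΣL (cartesianProduct xs ys) f ≡ ΣL xs (λ x → ΣL ys (λ y → f (x , y)))
ΣL-cartesianProduct []       ys f = refl
ΣL-cartesianProduct (x ∷ xs) ys f =
  trans (ΣL-++ (map (x ,_) ys) _ f) (cong₂ _+_ (ΣL-map (x ,_) ys f) (ΣL-cartesianProduct xs ys f))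

ΣL-applyUpTo : ∀ N (g f : ℕ → ℕ) → ΣL (applyUpTo g N) f ≡ Σ< N (f ∘ g)
ΣL-applyUpTo zero    g f = refl
ΣL-applyUpTo (suc N) g f = cong (f (g 0) +_) (ΣL-applyUpTo N (g ∘ suc) f)

ΣL-upTo : ∀ N (f : ℕ → ℕ) → ΣL (upTo N) f ≡ Σ< N f
ΣL-upTo N = ΣL-applyUpTo N id

-- The polynomial Σ_{x ∈ xs} mult x · t^{deg x}.
series : {A : Set} → List A → (A → ℕ) → (A → ℕ) → ℕ → ℕ
series xs deg mult m = ΣL xs (λ x → δ (deg x) m * mult x)

ones : {A : Set} → A → ℕ
ones _ = 1

length-filter-≟ : ∀ {A : Set} (f : A → ℕ) n (xs : List A) →
                  length (filter (λ x → f x ≟ n) xs) ≡ series xs f ones n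
length-filter-≟ f n []       = refl
length-filter-≟ f n (x ∷ xs) with f x ≟ n
... | yes fx≡n = trans (cong length (filter-accept (λ x → f x ≟ n) fx≡n))
                       (cong₂ _+_ (sym (trans (cong (λ t → δ t n * 1) fx≡n) (cong (_* 1) (δ-refl n))))
                                  (length-filter-≟ f n xs))
... | no fx≢n  = trans (cong length (filter-reject (λ x → f x ≟ n) fx≢n))
                       (cong₂ _+_ (sym (cong (_* 1) (δ-≢ (f x) n fx≢n))) (length-filter-≟ f n xs))

boxSeries : (r : ℕ) → (Fin r → ℕ) → (Fin r → ℕ) → ℕ → ℕ
boxSeries r a b = series (boxTuples r b) (wsum r a) ones

geometric : ℕ → ℕ → ℕ → ℕ
geometric a B = series (upTo B) (a *_) ones

multichoose : ℕ → ℕ → ℕ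
multichoose r j = (r + j ∸ 1) C j

Σ<-multichoose : ∀ r s → Σ< (suc s) (multichoose r) ≡ multichoose (suc r) s
Σ<-multichoose r zero    = +-identityʳ _
Σ<-multichoose r (suc s) = begin
  Σ< (suc (suc s)) (multichoose r)                ≡⟨ Σ<-suc (suc s) (multichoose r) ⟩
  Σ< (suc s) (multichoose r) + multichoose r (suc s) ≡⟨ cong (_+ multichoose r (suc s)) (Σ<-multichoose r s) ⟩
  (r + s) C s + (r + suc s ∸ 1) C suc s           ≡⟨ cong (λ t → (r + s) C s + (t ∸ 1) C suc s) (+-suc r s) ⟩
  (r + s) C s + (r + s) C suc s                   ≡⟨ nCk+nC[k+1]≡[n+1]C[k+1] (r + s) s ⟩
  suc (r + s) C suc s                             ≡⟨ cong (λ t → t C suc s) (sym (+-suc r s)) ⟩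
  multichoose (suc r) (suc s)                     ∎
  where open ≡-Reasoning

multichoose-zero : ∀ j → multichoose 0 j ≡ δ 0 j
multichoose-zero zero    = refl
multichoose-zero (suc j) = k>n⇒nCk≡0 (n<1+n j)

m*n≡o⇒0<m : ∀ {m n o} .{{_ : NonZero o}} → m * n ≡ o → 0 < m
m*n≡o⇒0<m {zero}  {o = o} 0≡o = ⊥-elim (≢-nonZero⁻¹ o (sym 0≡o))
m*n≡o⇒0<m {suc m} _           = z<s

m*n≡o⇒0<n : ∀ {m n o} .{{_ : NonZero o}} → m * n ≡ o → 0 < n
m*n≡o⇒0<n {m} {n} m*n≡o = m*n≡o⇒0<m (trans (*-comm n m) m*n≡o)

module Truncated (N : ℕ) where

  infix 4 _≈_
  _≈_ : (ℕ → ℕ) → (ℕ → ℕ) → Set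
  f ≈ g = ∀ m → m < N → f m ≡ g m

  ≈-refl : ∀ {f} → f ≈ f
  ≈-refl _ _ = refl

  ≈-sym : ∀ {f g} → f ≈ g → g ≈ f
  ≈-sym f≈g m m<N = sym (f≈g m m<N)

  ≈-trans : ∀ {f g h} → f ≈ g → g ≈ h → f ≈ h
  ≈-trans f≈g g≈h m m<N = trans (f≈g m m<N) (g≈h m m<N)

  infixl 7 _⋆_
  _⋆_ : (ℕ → ℕ) → (ℕ → ℕ) → ℕ → ℕ
  (f ⋆ g) m = Σ< N (λ i → Σ< N (λ j → δ (i + j) m * (f i * g j)))

  ⋆-cong : ∀ {f f′ g g′} → f ≈ f′ → g ≈ g′ → f ⋆ g ≈ f′ ⋆ g′
  ⋆-cong f≈f′ g≈g′ m _ = Σ<-cong N (λ i i<N → Σ<-cong N (λ j j<N →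
    cong (δ (i + j) m *_) (cong₂ _*_ (f≈f′ i i<N) (g≈g′ j j<N))))

  ⋆-comm : ∀ f g → f ⋆ g ≈ g ⋆ f
  ⋆-comm f g m _ = trans (Σ<-comm N N _) (Σ<-cong N (λ j _ → Σ<-cong N (λ i _ →
    cong₂ _*_ (cong (λ t → δ t m) (+-comm i j)) (*-comm (f i) (g j)))))

  Σ<²-δ : ∀ {m} p q c → m < N →
          Σ< N (λ i → Σ< N (λ j → δ p i * (δ q j * (δ (i + j) m * c)))) ≡ δ (p + q) m * c
  Σ<²-δ {m} p q c m<N = begin
    Σ< N (λ i → Σ< N (λ j → δ p i * (δ q j * (δ (i + j) m * c))))
      ≡⟨ Σ<-cong N (λ i _ → sym (*-distribˡ-Σ< N (δ p i) _)) ⟩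
    Σ< N (λ i → δ p i * Σ< N (λ j → δ q j * (δ (i + j) m * c)))
      ≡⟨ Σ<-cong N (λ i _ → cong (δ p i *_) (Σ<-δ N q _ (λ N≤q → vanish (m≤n+m q i) N≤q))) ⟩
    Σ< N (λ i → δ p i * (δ (i + q) m * c))
      ≡⟨ Σ<-δ N p _ (vanish (m≤m+n p q)) ⟩
    δ (p + q) m * c ∎
    where
    open ≡-Reasoning
    vanish : ∀ {t s} → t ≤ s → N ≤ t → δ s m * c ≡ 0
    vanish t≤s N≤t = cong (_* c) (δ-> (<-≤-trans m<N (≤-trans N≤t t≤s)))

  series-⋆ : ∀ {A B : Set} (xs : List A) (ys : List B) α β u w →
             series xs α u ⋆ series ys β w ≈ λ m → ΣL xs (λ x → ΣL ys (λ y → δ (α x + β y) m * (u x * w y)))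
  series-⋆ {A} {B} xs ys α β u w m m<N = begin
    (series xs α u ⋆ series ys β w) m
      ≡⟨ Σ<-cong N (λ i _ → Σ<-cong N (λ j _ → expand i j)) ⟩
    Σ< N (λ i → Σ< N (λ j → ΣL xs (λ x → ΣL ys (λ y → T x y i j))))
      ≡⟨ Σ<²-ΣL-comm xs _ ⟩
    ΣL xs (λ x → Σ< N (λ i → Σ< N (λ j → ΣL ys (λ y → T x y i j))))
      ≡⟨ ΣL-cong xs (λ x → Σ<²-ΣL-comm ys _) ⟩
    ΣL xs (λ x → ΣL ys (λ y → Σ< N (λ i → Σ< N (λ j → T x y i j))))
      ≡⟨ ΣL-cong xs (λ x → ΣL-cong ys (λ y → Σ<²-δ (α x) (β y) (u x * w y) m<N)) ⟩
    ΣL xs (λ x → ΣL ys (λ y → δ (α x + β y) m * (u x * w y))) ∎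
    where
    open ≡-Reasoning
    T : A → B → ℕ → ℕ → ℕ
    T x y i j = δ (α x) i * (δ (β y) j * (δ (i + j) m * (u x * w y)))
    Σ<²-ΣL-comm : ∀ {C : Set} (zs : List C) (f : C → ℕ → ℕ → ℕ) →
                  Σ< N (λ i → Σ< N (λ j → ΣL zs (λ z → f z i j))) ≡ ΣL zs (λ z → Σ< N (λ i → Σ< N (f z i)))
    Σ<²-ΣL-comm zs f =
      trans (Σ<-cong N (λ i _ → sym (ΣL-Σ<-comm zs N _))) (sym (ΣL-Σ<-comm zs N _))
    rearrange : ∀ e p a q b → e * ((p * a) * (q * b)) ≡ p * (q * (e * (a * b)))
    rearrange = solve-∀
    expand : ∀ i j → δ (i + j) m * (series xs α u i * series ys β w j) ≡ ΣL xs (λ x → ΣL ys (λ y → T x y i j))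
    expand i j = begin
      δ (i + j) m * (series xs α u i * series ys β w j)
        ≡⟨ cong (δ (i + j) m *_) (ΣL-*-ΣL xs ys (λ x → δ (α x) i * u x) (λ y → δ (β y) j * w y)) ⟩
      δ (i + j) m * ΣL xs (λ x → ΣL ys (λ y → (δ (α x) i * u x) * (δ (β y) j * w y)))
        ≡⟨ *-distribˡ-ΣL xs (δ (i + j) m) _ ⟩
      ΣL xs (λ x → δ (i + j) m * ΣL ys (λ y → (δ (α x) i * u x) * (δ (β y) j * w y)))
        ≡⟨ ΣL-cong xs (λ x → *-distribˡ-ΣL ys (δ (i + j) m) _) ⟩
      ΣL xs (λ x → ΣL ys (λ y → δ (i + j) m * ((δ (α x) i * u x) * (δ (β y) j * w y))))
        ≡⟨ ΣL-cong xs (λ x → ΣL-cong ys (λ y → rearrange (δ (i + j) m) (δ (α x) i) (u x) (δ (β y) j) (w y))) ⟩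
      ΣL xs (λ x → ΣL ys (λ y → T x y i j)) ∎

  ≈-series-upTo : ∀ f → f ≈ series (upTo N) id f
  ≈-series-upTo f m m<N = sym (begin
    series (upTo N) id f m          ≡⟨ ΣL-upTo N _ ⟩
    Σ< N (λ i → δ i m * f i)        ≡⟨ Σ<-cong N (λ i _ → cong (_* f i) (δ-sym i m)) ⟩
    Σ< N (λ i → δ m i * f i)        ≡⟨ Σ<-δ N m f (λ N≤m → ⊥-elim (<⇒≱ m<N N≤m)) ⟩
    f m                             ∎)
    where open ≡-Reasoning

  ⋆-≈-series : ∀ f g → f ⋆ g ≈ series (cartesianProduct (upTo N) (upTo N))
                                       (λ (i , j) → i + j) (λ (i , j) → f i * g j)
  ⋆-≈-series f g m m<N = begin
    (f ⋆ g) m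
      ≡⟨ ⋆-cong (≈-series-upTo f) (≈-series-upTo g) m m<N ⟩
    (series (upTo N) id f ⋆ series (upTo N) id g) m
      ≡⟨ series-⋆ (upTo N) (upTo N) id id f g m m<N ⟩
    ΣL (upTo N) (λ i → ΣL (upTo N) (λ j → δ (i + j) m * (f i * g j)))
      ≡⟨ ΣL-cartesianProduct (upTo N) (upTo N) (λ (i , j) → δ (i + j) m * (f i * g j)) ⟨
    series (cartesianProduct (upTo N) (upTo N)) (λ (i , j) → i + j) (λ (i , j) → f i * g j) m ∎
    where open ≡-Reasoning

  ⋆-assoc : ∀ f g h → (f ⋆ g) ⋆ h ≈ f ⋆ (g ⋆ h)
  ⋆-assoc f g h m m<N = begin
    ((f ⋆ g) ⋆ h) m
      ≡⟨ ⋆-cong (⋆-≈-series f g) (≈-series-upTo h) m m<N ⟩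
    (series I² (λ (i , j) → i + j) (λ (i , j) → f i * g j) ⋆ series I id h) m
      ≡⟨ series-⋆ I² I (λ (i , j) → i + j) id (λ (i , j) → f i * g j) h m m<N ⟩
    ΣL I² (λ (i , j) → ΣL I (λ k → δ ((i + j) + k) m * ((f i * g j) * h k)))
      ≡⟨ ΣL-cartesianProduct I I _ ⟩
    ΣL I (λ i → ΣL I (λ j → ΣL I (λ k → δ ((i + j) + k) m * ((f i * g j) * h k))))
      ≡⟨ ΣL-cong I (λ i → ΣL-cong I (λ j → ΣL-cong I (λ k →
           cong₂ (λ s t → δ s m * t) (+-assoc i j k) (*-assoc (f i) (g j) (h k))))) ⟩
    ΣL I (λ i → ΣL I (λ j → ΣL I (λ k → δ (i + (j + k)) m * (f i * (g j * h k)))))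
      ≡⟨ ΣL-cong I (λ i → ΣL-cartesianProduct I I _) ⟨
    ΣL I (λ i → ΣL I² (λ (j , k) → δ (i + (j + k)) m * (f i * (g j * h k))))
      ≡⟨ series-⋆ I I² id (λ (j , k) → j + k) f (λ (j , k) → g j * h k) m m<N ⟨
    (series I id f ⋆ series I² (λ (j , k) → j + k) (λ (j , k) → g j * h k)) m
      ≡⟨ ⋆-cong (≈-series-upTo f) (⋆-≈-series g h) m m<N ⟨
    (f ⋆ (g ⋆ h)) m ∎
    where
    open ≡-Reasoning
    I : List ℕ
    I = upTo N
    I² : List (ℕ × ℕ)
    I² = cartesianProduct I I

  ⋆-commutativeSemigroup : CommutativeSemigroup 0ℓ 0ℓ
  ⋆-commutativeSemigroup = record
    { Carrier                = ℕ → ℕ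
    ; _≈_                    = _≈_
    ; _∙_                    = _⋆_
    ; isCommutativeSemigroup = record
      { isSemigroup = record
        { isMagma = record
          { isEquivalence = record { refl = ≈-refl ; sym = ≈-sym ; trans = ≈-trans }
          ; ∙-cong        = ⋆-cong
          }
        ; assoc   = ⋆-assoc
        }
      ; comm        = ⋆-comm
      }
    }

  open CommutativeSemigroup ⋆-commutativeSemigroup using () renaming (setoid to ≈-setoid)
  open import Algebra.Properties.CommutativeSemigroup ⋆-commutativeSemigroup using ()
    renaming (interchange to ⋆-interchange)

  ⋆-identityˡ : ∀ g → δ 0 ⋆ g ≈ g
  ⋆-identityˡ g m m<N = begin
    (δ 0 ⋆ g) m
      ≡⟨ ⋆-cong δ0≈series (≈-series-upTo g) m m<N ⟩
    (series (0 ∷ []) id ones ⋆ series (upTo N) id g) m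
      ≡⟨ series-⋆ (0 ∷ []) (upTo N) id id ones g m m<N ⟩
    ΣL (upTo N) (λ j → δ j m * (1 * g j)) + 0
      ≡⟨ trans (+-identityʳ _) (ΣL-cong (upTo N) (λ j → cong (δ j m *_) (*-identityˡ (g j)))) ⟩
    series (upTo N) id g m
      ≡⟨ ≈-series-upTo g m m<N ⟨
    g m ∎
    where
    open ≡-Reasoning
    δ0≈series : δ 0 ≈ series (0 ∷ []) id ones
    δ0≈series i _ = sym (trans (+-identityʳ _) (*-identityʳ (δ 0 i)))

  ones-⋆ : ∀ g s → s < N → (ones ⋆ g) s ≡ Σ< (suc s) g
  ones-⋆ g s s<N = begin
    (ones ⋆ g) s        ≡⟨ Σ<-comm N N _ ⟩
    Σ< N G              ≡⟨ Σ<-truncate (suc s) N G s<N G≡0 ⟩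
    Σ< (suc s) G        ≡⟨ Σ<-cong (suc s) (λ j j<1+s → G≡g j (≤-pred j<1+s)) ⟩
    Σ< (suc s) g        ∎
    where
    open ≡-Reasoning
    G : ℕ → ℕ
    G j = Σ< N (λ i → δ (i + j) s * (1 * g j))
    G≡0 : ∀ j → suc s ≤ j → G j ≡ 0
    G≡0 j s<j = Σ<-zeros N (λ i _ → cong (_* (1 * g j)) (δ-> (<-≤-trans s<j (m≤n+m j i))))
    G≡g : ∀ j → j ≤ s → G j ≡ g j
    G≡g j j≤s = begin
      Σ< N (λ i → δ (i + j) s * (1 * g j))
        ≡⟨ Σ<-cong N (λ i _ → cong (_* (1 * g j)) (trans (cong (λ t → δ t s) (+-comm i j))
             (trans (δ-+-∸ j i s j≤s) (δ-sym i (s ∸ j))))) ⟩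
      Σ< N (λ i → δ (s ∸ j) i * (1 * g j))
        ≡⟨ Σ<-δ N (s ∸ j) _ (λ N≤s∸j → ⊥-elim (<⇒≱ (≤-<-trans (m∸n≤m s j) s<N) N≤s∸j)) ⟩
      1 * g j
        ≡⟨ *-identityˡ (g j) ⟩
      g j ∎

  ones-⋆-multichoose : ∀ r → ones ⋆ multichoose r ≈ multichoose (suc r)
  ones-⋆-multichoose r s s<N = trans (ones-⋆ (multichoose r) s s<N) (Σ<-multichoose r s)

  -- f(t^D)
  dilate : ℕ → (ℕ → ℕ) → ℕ → ℕ
  dilate D f = series (upTo N) (D *_) f

  dilate-cong : ∀ D {f g} → f ≈ g → dilate D f ≈ dilate D g
  dilate-cong D {f} {g} f≈g m _ = begin
    dilate D f m                    ≡⟨ ΣL-upTo N _ ⟩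
    Σ< N (λ j → δ (D * j) m * f j)  ≡⟨ Σ<-cong N (λ j j<N → cong (δ (D * j) m *_) (f≈g j j<N)) ⟩
    Σ< N (λ j → δ (D * j) m * g j)  ≡⟨ ΣL-upTo N _ ⟨
    dilate D g m                    ∎
    where open ≡-Reasoning

  dilate-δ0 : ∀ D → dilate D (δ 0) ≈ δ 0
  dilate-δ0 D m m<N = begin
    dilate D (δ 0) m                 ≡⟨ ΣL-upTo N _ ⟩
    Σ< N (λ j → δ (D * j) m * δ 0 j) ≡⟨ Σ<-cong N (λ j _ → *-comm (δ (D * j) m) (δ 0 j)) ⟩
    Σ< N (λ j → δ 0 j * δ (D * j) m) ≡⟨ Σ<-δ N 0 _ (λ N≤0 → ⊥-elim (<⇒≱ m<N (≤-trans N≤0 z≤n))) ⟩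
    δ (D * 0) m                      ≡⟨ cong (λ t → δ t m) (*-zeroʳ D) ⟩
    δ 0 m                            ∎
    where open ≡-Reasoning

  dilate-⋆ : ∀ D .{{_ : NonZero D}} f g → dilate D (f ⋆ g) ≈ dilate D f ⋆ dilate D g
  dilate-⋆ D f g m m<N = begin
    dilate D (f ⋆ g) m
      ≡⟨ ΣL-upTo N _ ⟩
    Σ< N (λ s → δ (D * s) m * (f ⋆ g) s)
      ≡⟨ Σ<-cong N (λ s _ → distribute s) ⟩
    Σ< N (λ s → Σ< N (λ i → Σ< N (λ j → δ (i + j) s * (δ (D * s) m * (f i * g j)))))
      ≡⟨ trans (Σ<-comm N N _) (Σ<-cong N (λ i _ → Σ<-comm N N _)) ⟩
    Σ< N (λ i → Σ< N (λ j → Σ< N (λ s → δ (i + j) s * (δ (D * s) m * (f i * g j)))))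
      ≡⟨ Σ<-cong N (λ i _ → Σ<-cong N (λ j _ → Σ<-δ N (i + j) _ (vanish i j))) ⟩
    Σ< N (λ i → Σ< N (λ j → δ (D * (i + j)) m * (f i * g j)))
      ≡⟨ Σ<-cong N (λ i _ → Σ<-cong N (λ j _ → cong (λ t → δ t m * (f i * g j)) (*-distribˡ-+ D i j))) ⟩
    Σ< N (λ i → Σ< N (λ j → δ (D * i + D * j) m * (f i * g j)))
      ≡⟨ trans (ΣL-upTo N _) (Σ<-cong N (λ i _ → ΣL-upTo N _)) ⟨
    ΣL (upTo N) (λ i → ΣL (upTo N) (λ j → δ (D * i + D * j) m * (f i * g j)))
      ≡⟨ series-⋆ (upTo N) (upTo N) (D *_) (D *_) f g m m<N ⟨
    (dilate D f ⋆ dilate D g) m ∎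
    where
    open ≡-Reasoning
    distribute : ∀ s → δ (D * s) m * (f ⋆ g) s ≡
                       Σ< N (λ i → Σ< N (λ j → δ (i + j) s * (δ (D * s) m * (f i * g j))))
    distribute s = trans (*-distribˡ-Σ< N (δ (D * s) m) _) (Σ<-cong N (λ i _ →
      trans (*-distribˡ-Σ< N (δ (D * s) m) _) (Σ<-cong N (λ j _ →
        m*[n*o]≡n*[m*o] (δ (D * s) m) (δ (i + j) s) (f i * g j)))))
    vanish : ∀ i j → N ≤ i + j → δ (D * (i + j)) m * (f i * g j) ≡ 0
    vanish i j N≤i+j = cong (_* (f i * g j)) (δ-> (<-≤-trans m<N (≤-trans N≤i+j (m≤n*m (i + j) D))))

  boxSeries-zero : ∀ a b → boxSeries 0 a b ≈ δ 0
  boxSeries-zero a b m _ = trans (+-identityʳ _) (*-identityʳ _)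

  boxSeries-suc : ∀ r a b → boxSeries (suc r) a b ≈ geometric (a zero) (b zero) ⋆ boxSeries r (a ∘ suc) (b ∘ suc)
  boxSeries-suc r a b m m<N = begin
    boxSeries (suc r) a b m
      ≡⟨ ΣL-concatMap (λ v → map (cons v) box) (upTo (b zero)) _ ⟩
    ΣL (upTo (b zero)) (λ v → ΣL (map (cons v) box) (λ x → δ (wsum (suc r) a x) m * 1))
      ≡⟨ ΣL-cong (upTo (b zero)) (λ v → ΣL-map (cons v) box _) ⟩
    ΣL (upTo (b zero)) (λ v → ΣL box (λ x → δ (a zero * v + wsum r (a ∘ suc) x) m * (1 * 1)))
      ≡⟨ series-⋆ (upTo (b zero)) box (a zero *_) (wsum r (a ∘ suc)) ones ones m m<N ⟨
    (geometric (a zero) (b zero) ⋆ boxSeries r (a ∘ suc) (b ∘ suc)) m ∎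
    where
    open ≡-Reasoning
    box : List (Fin r → ℕ)
    box = boxTuples r (b ∘ suc)

  geometric-factor : ∀ {a d D} → 0 < a → 0 < d → a * d ≡ D → geometric a N ≈ geometric D N ⋆ geometric a d
  geometric-factor {a} {d} {D} a>0 d>0 a*d≡D m m<N = begin
    geometric a N m
      ≡⟨ ΣL-upTo N h ⟩
    Σ< N h
      ≡⟨ Σ<-truncate N (N * d) h (m≤m*n N d {{>-nonZero d>0}}) vanish ⟨
    Σ< (N * d) h
      ≡⟨ Σ<-* N d h ⟩
    Σ< N (λ q → Σ< d (λ v → h (q * d + v)))
      ≡⟨ Σ<-cong N (λ q _ → Σ<-cong d (λ v _ → cong (λ t → δ t m * 1) (split q v))) ⟩
    Σ< N (λ q → Σ< d (λ v → δ (D * q + a * v) m * (1 * 1)))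
      ≡⟨ trans (ΣL-upTo N _) (Σ<-cong N (λ q _ → ΣL-upTo d _)) ⟨
    ΣL (upTo N) (λ q → ΣL (upTo d) (λ v → δ (D * q + a * v) m * (1 * 1)))
      ≡⟨ series-⋆ (upTo N) (upTo d) (D *_) (a *_) ones ones m m<N ⟨
    (geometric D N ⋆ geometric a d) m ∎
    where
    open ≡-Reasoning
    h : ℕ → ℕ
    h v = δ (a * v) m * 1
    vanish : ∀ v → N ≤ v → h v ≡ 0
    vanish v N≤v = cong (_* 1) (δ-> (<-≤-trans m<N (≤-trans N≤v (m≤n*m v a {{>-nonZero a>0}}))))
    expand : ∀ a d q v → a * (q * d + v) ≡ (a * d) * q + a * v
    expand = solve-∀
    split : ∀ q v → a * (q * d + v) ≡ D * q + a * v
    split q v = trans (expand a d q v) (cong (λ t → t * q + a * v) a*d≡D)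

  dilate-multichoose-suc : ∀ D .{{_ : NonZero D}} r →
                           dilate D (multichoose (suc r)) ≈ geometric D N ⋆ dilate D (multichoose r)
  dilate-multichoose-suc D r =
    ≈-trans (dilate-cong D (≈-sym (ones-⋆-multichoose r))) (dilate-⋆ D ones (multichoose r))

  boxSeries-factor : ∀ r (a d : Fin r → ℕ) D .{{_ : NonZero D}} → (∀ k → a k * d k ≡ D) →
                     boxSeries r a (λ _ → N) ≈ dilate D (multichoose r) ⋆ boxSeries r a d
  boxSeries-factor zero a d D _ = begin
    boxSeries 0 a (λ _ → N)            ≈⟨ boxSeries-zero a (λ _ → N) ⟩
    δ 0                                ≈⟨ ⋆-identityˡ (δ 0) ⟨
    δ 0 ⋆ δ 0                          ≈⟨ ⋆-cong (dilate-δ0 D) (boxSeries-zero a d) ⟨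
    dilate D (δ 0) ⋆ boxSeries 0 a d   ≈⟨ ⋆-cong (dilate-cong D (λ j _ → multichoose-zero j)) ≈-refl ⟨
    dilate D (multichoose 0) ⋆ boxSeries 0 a d ∎
    where open SetoidReasoning ≈-setoid
  boxSeries-factor (suc r) a d D a*d≡D = begin
    boxSeries (suc r) a (λ _ → N)
      ≈⟨ boxSeries-suc r a (λ _ → N) ⟩
    geometric (a zero) N ⋆ boxSeries r a′ (λ _ → N)
      ≈⟨ ⋆-cong {geometric (a zero) N} ≈-refl (boxSeries-factor r a′ d′ D (a*d≡D ∘ suc)) ⟩
    geometric (a zero) N ⋆ (dilate D (multichoose r) ⋆ boxSeries r a′ d′)
      ≈⟨ ⋆-cong {g = G} (geometric-factor a₀>0 d₀>0 (a*d≡D zero)) ≈-refl ⟩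
    (geometric D N ⋆ geometric (a zero) (d zero)) ⋆ (dilate D (multichoose r) ⋆ boxSeries r a′ d′)
      ≈⟨ ⋆-interchange (geometric D N) (geometric (a zero) (d zero)) (dilate D (multichoose r)) (boxSeries r a′ d′) ⟩
    (geometric D N ⋆ dilate D (multichoose r)) ⋆ (geometric (a zero) (d zero) ⋆ boxSeries r a′ d′)
      ≈⟨ ⋆-cong (dilate-multichoose-suc D r) (boxSeries-suc r a d) ⟨
    dilate D (multichoose (suc r)) ⋆ boxSeries (suc r) a d ∎
    where
    open SetoidReasoning ≈-setoid
    a′ d′ : Fin r → ℕ
    a′ = a ∘ suc
    d′ = d ∘ suc
    G : ℕ → ℕ
    G = dilate D (multichoose r) ⋆ boxSeries r a′ d′
    a₀>0 : 0 < a zero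
    a₀>0 = m*n≡o⇒0<m (a*d≡D zero)
    d₀>0 : 0 < d zero
    d₀>0 = m*n≡o⇒0<n {a zero} (a*d≡D zero)

module _ (n : ℕ) where

  open Truncated (suc n)

  dilate-⋆-boxSeries : ∀ r (a d : Fin r → ℕ) (c : ℕ → ℕ) D .{{_ : NonZero D}} →
    (dilate D c ⋆ boxSeries r a d) n ≡ sum (map (λ j → c j * countBox r a d (n ∸ j * D)) (upTo (suc (n / D))))
  dilate-⋆-boxSeries r a d c D = begin
    (dilate D c ⋆ boxSeries r a d) n
      ≡⟨ series-⋆ (upTo (suc n)) box (D *_) (wsum r a) c ones n ≤-refl ⟩
    ΣL (upTo (suc n)) H
      ≡⟨ ΣL-upTo (suc n) H ⟩
    Σ< (suc n) H
      ≡⟨ Σ<-truncate (suc (n / D)) (suc n) H (s≤s (m/n≤m n D)) H≡0 ⟩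
    Σ< (suc (n / D)) H
      ≡⟨ Σ<-cong (suc (n / D)) (λ j j<1+n/D → H≡G j (≤-pred j<1+n/D)) ⟩
    Σ< (suc (n / D)) G
      ≡⟨ trans (sum-map G (upTo (suc (n / D)))) (ΣL-upTo (suc (n / D)) G) ⟨
    sum (map G (upTo (suc (n / D)))) ∎
    where
    open ≡-Reasoning
    box : List (Fin r → ℕ)
    box = boxTuples r d
    H G : ℕ → ℕ
    H j = ΣL box (λ x → δ (D * j + wsum r a x) n * (c j * 1))
    G j = c j * countBox r a d (n ∸ j * D)
    H≡0 : ∀ j → suc (n / D) ≤ j → H j ≡ 0
    H≡0 j n/D<j = ΣL-zeros box (λ x → cong (_* (c j * 1)) (δ-> (<-≤-trans n<D*j (m≤m+n (D * j) (wsum r a x)))))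
      where
      j*D≤n⇒j≤n/D : j * D ≤ n → j ≤ n / D
      j*D≤n⇒j≤n/D j*D≤n = subst (_≤ n / D) (m*n/n≡m j D) (/-monoˡ-≤ D j*D≤n)
      n<D*j : n < D * j
      n<D*j = subst (n <_) (*-comm j D) (≰⇒> (λ j*D≤n → <⇒≱ n/D<j (j*D≤n⇒j≤n/D j*D≤n)))
    H≡G : ∀ j → j ≤ n / D → H j ≡ G j
    H≡G j j≤n/D = begin
      ΣL box (λ x → δ (D * j + wsum r a x) n * (c j * 1))
        ≡⟨ ΣL-cong box (λ x → trans (cong (λ t → δ (t + wsum r a x) n * (c j * 1)) (*-comm D j))
             (trans (cong (_* (c j * 1)) (δ-+-∸ (j * D) (wsum r a x) n j*D≤n))
                    (m*[n*o]≡n*[m*o] (δ (wsum r a x) (n ∸ j * D)) (c j) 1))) ⟩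
      ΣL box (λ x → c j * (δ (wsum r a x) (n ∸ j * D) * 1))
        ≡⟨ *-distribˡ-ΣL box (c j) _ ⟨
      c j * boxSeries r a d (n ∸ j * D)
        ≡⟨ cong (c j *_) (length-filter-≟ (wsum r a) (n ∸ j * D) box) ⟨
      G j ∎
      where
      j*D≤n : j * D ≤ n
      j*D≤n = ≤-trans (*-monoˡ-≤ D j≤n/D) (m/n*n≤m n D)

proposition2p2 : (r : ℕ) → 1 ≤ r → (a : Fin r → ℕ) → (pos : ∀ k → 0 < a k)
    → (D : ℕ) → (D>0 : 0 < D) → (∀ k → a k ∣ D) → (n : ℕ)
    → pa r a n ≡ sum (map (λ j → ((r + j ∸ 1) C j) * fa r a pos D (n ∸ j * D))
                          (upTo (suc (_/_ n D {{>-nonZero D>0}}))))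
proposition2p2 r _ a pos D D>0 a∣D n = begin
  pa r a n
    ≡⟨ length-filter-≟ (wsum r a) n (boxTuples r (λ _ → suc n)) ⟩
  boxSeries r a (λ _ → suc n) n
    ≡⟨ boxSeries-factor r a d D a*d≡D n ≤-refl ⟩
  (dilate D (multichoose r) ⋆ boxSeries r a d) n
    ≡⟨ dilate-⋆-boxSeries n r a d (multichoose r) D ⟩
  sum (map (λ j → multichoose r j * fa r a pos D (n ∸ j * D)) (upTo (suc (n / D)))) ∎
  where
  open ≡-Reasoning
  open Truncated (suc n)
  instance
    D≢0 : NonZero D
    D≢0 = >-nonZero D>0
  d : Fin r → ℕ
  d k = _/_ D (a k) {{>-nonZero (pos k)}}
  a*d≡D : ∀ k → a k * d k ≡ D
  a*d≡D k = m*[n/m]≡n {{>-nonZero (pos k)}} (a∣D k)
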